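{- Let $p$ be a prime, $\alpha$ a primitive root modulo $p$, and $\mathcal{R}_p=\{(i,j)\in\mathbb{Z}^2:\alpha^j\equiv i\bmod p\}$. Let $d,e$ be integers with $d\not\equiv 0\bmod p$ and $e\not\equiv 0\bmod (p-1)$. Suppose $\mathcal{R}_p$ contains points $A=(i_1,j_1)$, $B=(i_1+d,j_1+e)$, $A'=(i_2,j_2)$ and $B'=(i_2+d,j_2+e)$. Then $A\equiv A'$ and $B\equiv B'$.
   Context: Two points $(i,j),(i',j')\in\mathbb{Z}^2$ are called equivalent, written $(i,j)\equiv(i',j')$, if $i'=i+\lambda p$ and $j'=j+\mu(p-1)$ for some $\lambda,\mu\in\mathbb{Z}$. -}

module Defs where

open import Data.Nat.Base as ℕ using (ℕ)
open import Data.Integer.Base using (ℤ; +_; -[1+_]; _+_; _-_; _*_; _^_; -_; 0ℤ; 1ℤ)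
open import Data.Integer.Divisibility using (_∣_)
open import Data.Product using (_×_; _,_; ∃; ∃-syntax)
open import Relation.Binary.PropositionalEquality using (_≡_)
open import Relation.Nullary using (¬_)

_≡_[mod_] : ℤ → ℤ → ℤ → Set
a ≡ b [mod m ] = m ∣ (a - b)

-- α^j ≡ i (mod p) for an integer exponent j, with α invertible mod p:
-- for j = -(k+1) < 0 this means α^(k+1) * i ≡ 1 (mod p).
PowCong : ℕ → ℤ → ℤ → ℤ → Set
PowCong p α (+ k)     i = (α ^ k) ≡ i [mod (+ p) ]
PowCong p α -[1+ k ]  i = ((α ^ ℕ.suc k) * i) ≡ 1ℤ [mod (+ p) ]

IsPrimitiveRoot : ℕ → ℤ → Set
IsPrimitiveRoot p α =
  ¬ ((+ p) ∣ α) ×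
  ((α ^ (p ℕ.∸ 1)) ≡ 1ℤ [mod (+ p) ]) ×
  (∀ (k : ℕ) → 0 ℕ.< k → k ℕ.< p ℕ.∸ 1 → ¬ ((α ^ k) ≡ 1ℤ [mod (+ p) ]))

InR : ℕ → ℤ → ℤ × ℤ → Set
InR p α (i , j) = PowCong p α j i

PtEquiv : ℕ → ℤ × ℤ → ℤ × ℤ → Set
PtEquiv p (i , j) (i' , j') =
  ∃[ l ] ∃[ m ] (i' ≡ i + l * (+ p)) × (j' ≡ j + m * (+ (p ℕ.∸ 1)))

-- Let r be the residue of e mod p - 1. Since A and B lie on R_p,
-- α^r i₁ ≡ α^r α^j₁ ≡ α^(j₁ + e) ≡ i₁ + d (mod p), i.e. (α^r - 1) i₁ ≡ d, and likewise
-- (α^r - 1) i₂ ≡ d. As α has order p - 1 and e ≢ 0 (mod p - 1), α^r - 1 is a unit mod p,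
-- so i₁ ≡ i₂; then α^j₁ ≡ α^j₂ and, by the order of α again, j₁ ≡ j₂ (mod p - 1).
-- Integer exponents are handled through their least non-negative residues mod p - 1.
module Submission where

open import Defs
open import Data.Nat.Base using (ℕ)
open import Data.Nat.Primality using (Prime)
open import Data.Integer.Base using (ℤ; +_; _+_; 0ℤ)
open import Data.Product using (_×_; _,_; proj₁; proj₂)
open import Relation.Nullary using (¬_)

open import Data.Nat.Base as ℕ using (suc; NonZero; _≤_; _<_; z<s)
import Data.Nat.Properties as ℕ
import Data.Nat.Divisibility as ℕ
open import Data.Nat.Primality using (euclidsLemma; ¬prime[0]; ¬prime[1])
import Data.Integer.Base as ℤ
open import Data.Integer.Base using (-[1+_]; _-_; _*_; _^_; -_; 1ℤ; ∣_∣)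
open import Data.Integer.Properties
  using (abs-*; +-inverseʳ; *-zeroˡ; pos-+; *-identityʳ; *-comm; m-n≡m⊖n; ∣⊖∣-≤;
         ^-distribˡ-+-*; ^-*-assoc; ^-zeroˡ)
open import Data.Integer.Divisibility.Signed as Signed using (divides; ∣ᵤ⇒∣; ∣⇒∣ᵤ; ∣m∣n⇒∣m+n; ∣m⇒∣-m; ∣n⇒∣m*n)
open import Data.Integer.Divisibility using (_∣_)
open import Data.Integer.DivMod using (_%_; _/_; a≡a%n+[a/n]*n; n%d<d)
open import Data.Integer.Tactic.RingSolver using (solve-∀)
open import Data.Sum using (_⊎_; inj₁; inj₂)
open import Function using (_∘_)
open import Level using (0ℓ)
open import Relation.Binary.Bundles using (Setoid)
open import Relation.Binary.PropositionalEquality using (_≡_; refl; sym; trans; cong; subst)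
open import Relation.Nullary using (contradiction)

module Congruence (m : ℤ) where

  -- Unlike a ≡ b [mod m ] itself, this record keeps a and b inferable by unification.
  infix 4 _≈_
  record _≈_ (a b : ℤ) : Set where
    constructor divides-difference
    field m∣a-b : m Signed.∣ (a - b)
  open _≈_

  fromMod : ∀ {a b} → a ≡ b [mod m ] → a ≈ b
  fromMod {a} {b} a≡b = divides-difference (∣ᵤ⇒∣ {m} {a - b} a≡b)

  toMod : ∀ {a b} → a ≈ b → a ≡ b [mod m ]
  toMod {a} {b} a≈b = ∣⇒∣ᵤ {m} {a - b} (m∣a-b a≈b)

  private
    ≈-from-sum : ∀ {a b c d x y} → (a - b) + (c - d) ≡ x - y → a ≈ b → c ≈ d → x ≈ y
    ≈-from-sum eq a≈b c≈d = divides-difference (subst (m Signed.∣_) eq (∣m∣n⇒∣m+n (m∣a-b a≈b) (m∣a-b c≈d)))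

  ≈-reflexive : ∀ {a b} → a ≡ b → a ≈ b
  ≈-reflexive {a} refl = divides-difference (divides 0ℤ (trans (+-inverseʳ a) (sym (*-zeroˡ m))))

  ≈-refl : ∀ {a} → a ≈ a
  ≈-refl = ≈-reflexive refl

  ≈-sym : ∀ {a b} → a ≈ b → b ≈ a
  ≈-sym {a} {b} a≈b = divides-difference (subst (m Signed.∣_) (negate a b) (∣m⇒∣-m (m∣a-b a≈b)))
    where
    negate : ∀ a b → - (a - b) ≡ b - a
    negate = solve-∀

  ≈-trans : ∀ {a b c} → a ≈ b → b ≈ c → a ≈ c
  ≈-trans {a} {b} {c} = ≈-from-sum (telescope a b c)
    where
    telescope : ∀ a b c → (a - b) + (b - c) ≡ a - c
    telescope = solve-∀

  ≈-setoid : Setoid 0ℓ 0ℓ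
  ≈-setoid = record
    { Carrier = ℤ ; _≈_ = _≈_
    ; isEquivalence = record { refl = ≈-refl ; sym = ≈-sym ; trans = ≈-trans } }

  +-cong : ∀ {a b c d} → a ≈ b → c ≈ d → a + c ≈ b + d
  +-cong {a} {b} {c} {d} = ≈-from-sum (regroup a b c d)
    where
    regroup : ∀ a b c d → (a - b) + (c - d) ≡ (a + c) - (b + d)
    regroup = solve-∀

  *-cong : ∀ {a b c d} → a ≈ b → c ≈ d → a * c ≈ b * d
  *-cong {a} {b} {c} {d} a≈b c≈d =
    divides-difference (subst (m Signed.∣_) (regroup a b c d)
      (∣m∣n⇒∣m+n (∣n⇒∣m*n c (m∣a-b a≈b)) (∣n⇒∣m*n b (m∣a-b c≈d))))
    where
    regroup : ∀ a b c d → c * (a - b) + b * (c - d) ≡ a * c - b * d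
    regroup = solve-∀

  ^-cong : ∀ {a b} n → a ≈ b → a ^ n ≈ b ^ n
  ^-cong ℕ.zero    a≈b = ≈-refl
  ^-cong (suc n) a≈b = *-cong a≈b (^-cong n a≈b)

  module _ .{{_ : ℤ.NonZero m}} where
    open import Relation.Binary.Reasoning.Setoid ≈-setoid

    ≈-% : ∀ i → i ≈ + (i % m)
    ≈-% i = divides-difference (divides (i / m)
      (trans (cong (_- + (i % m)) (a≡a%n+[a/n]*n i m)) (cancel (+ (i % m)) (i / m * m))))
      where
      cancel : ∀ r x → (r + x) - r ≡ x
      cancel = solve-∀

    %-+ : ∀ i j → + ((i + j) % m) ≈ + (i % m ℕ.+ j % m)
    %-+ i j = begin
      + ((i + j) % m)         ≈⟨ ≈-% (i + j) ⟨
      i + j                   ≈⟨ +-cong (≈-% i) (≈-% j) ⟩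
      + (i % m) + + (j % m)   ≡⟨ pos-+ (i % m) (j % m) ⟨
      + (i % m ℕ.+ j % m)     ∎

    +-%-neg : ∀ i → i + + ((- i) % m) ≈ 0ℤ
    +-%-neg i = begin
      i + + ((- i) % m)   ≈⟨ +-cong (≈-refl {i}) (≈-% (- i)) ⟨
      i + - i             ≡⟨ +-inverseʳ i ⟩
      0ℤ                  ∎

    %-≡⇒≈ : ∀ {i j} → i % m ≡ j % m → i ≈ j
    %-≡⇒≈ {i} {j} i%m≡j%m = begin
      i           ≈⟨ ≈-% i ⟩
      + (i % m)   ≡⟨ cong +_ i%m≡j%m ⟩
      + (j % m)   ≈⟨ ≈-% j ⟨
      j           ∎

module PrimeModulus (p : ℕ) (p-prime : Prime p) where
  open Congruence (+ p)

  ∣*⇒∣⊎∣ : ∀ a b → + p ∣ a * b → (+ p ∣ a) ⊎ (+ p ∣ b)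
  ∣*⇒∣⊎∣ a b p∣ab = euclidsLemma ∣ a ∣ ∣ b ∣ p-prime (subst (p ℕ.∣_) (abs-* a b) p∣ab)

  ∤⇒∤^ : ∀ {a} n → ¬ (+ p ∣ a) → ¬ (+ p ∣ a ^ n)
  ∤⇒∤^ ℕ.zero    _   p∣1 = ¬prime[1] (subst Prime (ℕ.∣1⇒≡1 p∣1) p-prime)
  ∤⇒∤^ {a} (suc n) p∤a p∣a^[1+n] with ∣*⇒∣⊎∣ a (a ^ n) p∣a^[1+n]
  ... | inj₁ p∣a   = p∤a p∣a
  ... | inj₂ p∣a^n = ∤⇒∤^ n p∤a p∣a^n

  *-cancelˡ-≈ : ∀ c {a b} → ¬ (+ p ∣ c) → c * a ≈ c * b → a ≈ b
  *-cancelˡ-≈ c {a} {b} p∤c ca≈cb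
    with ∣*⇒∣⊎∣ c (a - b) (subst (+ p ∣_) (factor c a b) (toMod ca≈cb))
    where
    factor : ∀ c a b → c * a - c * b ≡ c * (a - b)
    factor = solve-∀
  ... | inj₁ p∣c   = contradiction p∣c p∤c
  ... | inj₂ p∣a-b = fromMod p∣a-b

≡[mod]⇒PtEquiv : ∀ p {i j i′ j′} → i′ ≡ i [mod + p ] → j′ ≡ j [mod + (p ℕ.∸ 1) ] →
                 PtEquiv p (i , j) (i′ , j′)
≡[mod]⇒PtEquiv p {i} {j} {i′} {j′} i′≡i j′≡j
  with ∣ᵤ⇒∣ {+ p} {i′ - i} i′≡i | ∣ᵤ⇒∣ {+ (p ℕ.∸ 1)} {j′ - j} j′≡j
... | divides l i′-i≡lp | divides m j′-j≡mq =
  l , m , trans (sym (add-back i i′)) (cong (_+_ i) i′-i≡lp) ,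
          trans (sym (add-back j j′)) (cong (_+_ j) j′-j≡mq)
  where
  add-back : ∀ a b → a + (b - a) ≡ b
  add-back = solve-∀

≡[mod]⇒∣∸ : ∀ {n a b} → a ≤ b → (+ a) ≡ (+ b) [mod (+ n) ] → n ℕ.∣ b ℕ.∸ a
≡[mod]⇒∣∸ {n} {a} {b} a≤b = subst (n ℕ.∣_) (trans (cong ∣_∣ (m-n≡m⊖n a b)) (∣⊖∣-≤ a≤b))

-- The prime is passed as suc q, so that p ∸ 1 reduces to q.
module PrimitiveRoot (q : ℕ) .{{_ : NonZero q}} (p-prime : Prime (suc q))
                     (α : ℤ) (α-primitive : IsPrimitiveRoot (suc q) α) where
  open Congruence (+ suc q)
  open PrimeModulus (suc q) p-prime
  module Q = Congruence (+ q)
  open import Relation.Binary.Reasoning.Setoid ≈-setoid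

  private
    p∤α^ : ∀ n → ¬ (+ suc q ∣ α ^ n)
    p∤α^ n = ∤⇒∤^ {α} n (proj₁ α-primitive)

    α^q≈1 : α ^ q ≈ 1ℤ
    α^q≈1 = fromMod (proj₁ (proj₂ α-primitive))

    order : ∀ k → 0 < k → k < q → ¬ (α ^ k ≈ 1ℤ)
    order k 0<k k<q = proj₂ (proj₂ α-primitive) k 0<k k<q ∘ toMod

  ^-periodic : ∀ a t → α ^ (a ℕ.+ t ℕ.* q) ≈ α ^ a
  ^-periodic a t = begin
    α ^ (a ℕ.+ t ℕ.* q)    ≡⟨ ^-distribˡ-+-* α a (t ℕ.* q) ⟩
    α ^ a * α ^ (t ℕ.* q)  ≡⟨ cong (λ k → α ^ a * α ^ k) (ℕ.*-comm t q) ⟩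
    α ^ a * α ^ (q ℕ.* t)  ≡⟨ cong (α ^ a *_) (^-*-assoc α q t) ⟨
    α ^ a * (α ^ q) ^ t    ≈⟨ *-cong (≈-refl {α ^ a}) (^-cong t α^q≈1) ⟩
    α ^ a * 1ℤ ^ t         ≡⟨ cong (α ^ a *_) (^-zeroˡ t) ⟩
    α ^ a * 1ℤ             ≡⟨ *-identityʳ (α ^ a) ⟩
    α ^ a                  ∎

  ^-cong-mod-≤ : ∀ {a b} → a ≤ b → + a Q.≈ + b → α ^ b ≈ α ^ a
  ^-cong-mod-≤ {a} {b} a≤b a≡b with ≡[mod]⇒∣∸ a≤b (Q.toMod a≡b)
  ... | ℕ.divides t b∸a≡t*q = begin
    α ^ b               ≡⟨ cong (α ^_) (trans (sym (ℕ.m+[n∸m]≡n a≤b)) (cong (a ℕ.+_) b∸a≡t*q)) ⟩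
    α ^ (a ℕ.+ t ℕ.* q) ≈⟨ ^-periodic a t ⟩
    α ^ a               ∎

  ^-cong-mod : ∀ {a b} → + a Q.≈ + b → α ^ a ≈ α ^ b
  ^-cong-mod {a} {b} a≡b with ℕ.≤-total a b
  ... | inj₁ a≤b = ≈-sym (^-cong-mod-≤ a≤b a≡b)
  ... | inj₂ b≤a = ^-cong-mod-≤ b≤a (Q.≈-sym a≡b)

  ^≈1⇒≡0 : ∀ {t} → t < q → α ^ t ≈ 1ℤ → t ≡ 0
  ^≈1⇒≡0 {ℕ.zero}  _   _      = refl
  ^≈1⇒≡0 {suc t} t<q α^t≈1 = contradiction α^t≈1 (order (suc t) z<s t<q)

  ^-injective-≤ : ∀ {a b} → a ≤ b → b < q → α ^ a ≈ α ^ b → a ≡ b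
  ^-injective-≤ {a} {b} a≤b b<q α^a≈α^b =
    ℕ.≤-antisym a≤b (ℕ.m∸n≡0⇒m≤n (^≈1⇒≡0 (ℕ.≤-<-trans (ℕ.m∸n≤m b a) b<q) α^[b∸a]≈1))
    where
    α^[b∸a]≈1 : α ^ (b ℕ.∸ a) ≈ 1ℤ
    α^[b∸a]≈1 = *-cancelˡ-≈ (α ^ a) (p∤α^ a) (begin
      α ^ a * α ^ (b ℕ.∸ a)   ≡⟨ ^-distribˡ-+-* α a (b ℕ.∸ a) ⟨
      α ^ (a ℕ.+ (b ℕ.∸ a))   ≡⟨ cong (α ^_) (ℕ.m+[n∸m]≡n a≤b) ⟩
      α ^ b                   ≈⟨ α^a≈α^b ⟨
      α ^ a                   ≡⟨ *-identityʳ (α ^ a) ⟨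
      α ^ a * 1ℤ              ∎)

  ^-injective : ∀ {a b} → a < q → b < q → α ^ a ≈ α ^ b → a ≡ b
  ^-injective {a} {b} a<q b<q α^a≈α^b with ℕ.≤-total a b
  ... | inj₁ a≤b = ^-injective-≤ a≤b b<q α^a≈α^b
  ... | inj₂ b≤a = sym (^-injective-≤ b≤a a<q (≈-sym α^a≈α^b))

  inR⇒^% : ∀ {i j} → InR (suc q) α (i , j) → α ^ (j % + q) ≈ i
  inR⇒^% {i} {+ k} α^k≡i = begin
    α ^ ((+ k) % + q)   ≈⟨ ^-cong-mod (Q.≈-sym (Q.≈-% (+ k))) ⟩
    α ^ k               ≈⟨ fromMod α^k≡i ⟩
    i                   ∎
  inR⇒^% {i} { -[1+ k ] } α^[1+k]*i≡1 = *-cancelˡ-≈ (α ^ suc k) (p∤α^ (suc k)) (begin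
    α ^ suc k * α ^ r    ≡⟨ ^-distribˡ-+-* α (suc k) r ⟨
    α ^ (suc k ℕ.+ r)    ≈⟨ ^-cong-mod (Q.+-%-neg (+ suc k)) ⟩
    1ℤ                   ≈⟨ fromMod α^[1+k]*i≡1 ⟨
    α ^ suc k * i        ∎)
    where
    r : ℕ
    r = -[1+ k ] % + q

  ^%-+ : ∀ j e → α ^ ((j + e) % + q) ≈ α ^ (j % + q) * α ^ (e % + q)
  ^%-+ j e = begin
    α ^ ((j + e) % + q)               ≈⟨ ^-cong-mod (Q.%-+ j e) ⟩
    α ^ (j % + q ℕ.+ e % + q)         ≡⟨ ^-distribˡ-+-* α (j % + q) (e % + q) ⟩
    α ^ (j % + q) * α ^ (e % + q)     ∎

  ^%≉1 : ∀ {e} → ¬ (e ≡ 0ℤ [mod + q ]) → ¬ (α ^ (e % + q) ≈ 1ℤ)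
  ^%≉1 {e} e≢0 α^r≈1 = e≢0 (Q.toMod (Q.≈-trans (Q.≈-% e) (Q.≈-reflexive (cong +_ r≡0))))
    where
    r≡0 : e % + q ≡ 0
    r≡0 = ^≈1⇒≡0 (n%d<d e (+ q)) α^r≈1

  ^%-injective : ∀ {j j′} → α ^ (j % + q) ≈ α ^ (j′ % + q) → j Q.≈ j′
  ^%-injective {j} {j′} = Q.%-≡⇒≈ ∘ ^-injective (n%d<d j (+ q)) (n%d<d j′ (+ q))

  inR-translate : ∀ {i j d e} → InR (suc q) α (i , j) → InR (suc q) α (i + d , j + e) →
                  (α ^ (e % + q) - 1ℤ) * i ≈ d
  inR-translate {i} {j} {d} {e} A B = begin
    (R - 1ℤ) * i       ≡⟨ expand R i ⟩
    R * i + - i        ≈⟨ +-cong R*i≈i+d (≈-refl { - i}) ⟩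
    (i + d) + - i      ≡⟨ cancel i d ⟩
    d                  ∎
    where
    R : ℤ
    R = α ^ (e % + q)
    expand : ∀ R i → (R - 1ℤ) * i ≡ R * i + - i
    expand = solve-∀
    cancel : ∀ i d → (i + d) + - i ≡ d
    cancel = solve-∀
    R*i≈i+d : R * i ≈ i + d
    R*i≈i+d = begin
      R * i                   ≡⟨ *-comm R i ⟩
      i * R                   ≈⟨ *-cong (inR⇒^% A) (≈-refl {R}) ⟨
      α ^ (j % + q) * R       ≈⟨ ^%-+ j e ⟨
      α ^ ((j + e) % + q)     ≈⟨ inR⇒^% B ⟩
      i + d                   ∎

  same-translate⇒PtEquiv : ∀ {d e} → ¬ (e ≡ 0ℤ [mod + q ]) → ∀ i₁ j₁ i₂ j₂ →
    InR (suc q) α (i₁ , j₁) → InR (suc q) α (i₁ + d , j₁ + e) →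
    InR (suc q) α (i₂ , j₂) → InR (suc q) α (i₂ + d , j₂ + e) →
    PtEquiv (suc q) (i₁ , j₁) (i₂ , j₂) × PtEquiv (suc q) (i₁ + d , j₁ + e) (i₂ + d , j₂ + e)
  same-translate⇒PtEquiv {d} {e} e≢0 i₁ j₁ i₂ j₂ A B A′ B′ =
    ≡[mod]⇒PtEquiv (suc q) (toMod i₂≈i₁) (Q.toMod j₂≈j₁) ,
    ≡[mod]⇒PtEquiv (suc q) (toMod (+-cong i₂≈i₁ (≈-refl {d}))) (Q.toMod (Q.+-cong j₂≈j₁ (Q.≈-refl {e})))
    where
    i₂≈i₁ : i₂ ≈ i₁
    i₂≈i₁ = *-cancelˡ-≈ (α ^ (e % + q) - 1ℤ) (^%≉1 {e} e≢0 ∘ fromMod)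
              (≈-trans (inR-translate A′ B′) (≈-sym (inR-translate A B)))
    j₂≈j₁ : j₂ Q.≈ j₁
    j₂≈j₁ = ^%-injective (begin
      α ^ (j₂ % + q)   ≈⟨ inR⇒^% A′ ⟩
      i₂               ≈⟨ i₂≈i₁ ⟩
      i₁               ≈⟨ inR⇒^% A ⟨
      α ^ (j₁ % + q)   ∎)

lemma4 : (p : ℕ) → Prime p → (α : ℤ) → IsPrimitiveRoot p α →
    (d e : ℤ) → ¬ (d ≡ 0ℤ [mod (+ p) ]) → ¬ (e ≡ 0ℤ [mod (+ (p Data.Nat.Base.∸ 1)) ]) →
    (i₁ j₁ i₂ j₂ : ℤ) →
    InR p α (i₁ , j₁) → InR p α (i₁ + d , j₁ + e) →
    InR p α (i₂ , j₂) → InR p α (i₂ + d , j₂ + e) →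
    PtEquiv p (i₁ , j₁) (i₂ , j₂) × PtEquiv p (i₁ + d , j₁ + e) (i₂ + d , j₂ + e)
lemma4 ℕ.zero          p-prime = contradiction p-prime ¬prime[0]
lemma4 (suc ℕ.zero)    p-prime = contradiction p-prime ¬prime[1]
lemma4 (suc q@(suc _)) p-prime α α-primitive d e _ =
  PrimitiveRoot.same-translate⇒PtEquiv q p-prime α α-primitive {d} {e}
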